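{- For any $\ell\in\mathbb{N}$ there exists a graph $G$ such that $G\notin\mathrm{MTD}_\ell$, but $G\in\mathrm{TD}_1\mathrm{MW}_0$.
   Context: Graphs are finite and simple. Operations: $\circ,\bullet$ return the empty and the one-vertex graph; $\mathrm{Union}_t$ ($t\ge2$) is disjoint union; $\mathrm{Join}_t$ is disjoint union plus all edges between different arguments; $\mathrm{Inc}_{x,E_x}(G)=(V\cup\{x\},E\cup E_x)$ for $G=(V,E)$, $x\notin V$, $E_x\subseteq\{\{x,v\}\mid v\in V\}$; $\mathrm{Subst}_H(G_1,\dots,G_t)$ for $V(H)=\{v_1,\dots,v_t\}$ replaces each $v_i$ by a disjoint copy of $G_i$ and adds all edges between $V(G_i)$ and $V(G_j)$ whenever $\{v_i,v_j\}\in E(H)$. A graph has an algebraic expression over a set of operations if it is (up to renaming) the value of it; the empty graph corresponds to the empty expression. The nesting depth of an operation is the maximum number of expression-tree nodes labelled by it on a root-to-leaf path. $\mathrm{td}(G)$ is the least $k$ such that $G$ has an expression over $\{\circ,\mathrm{Union}\}\cup\{\mathrm{Inc}_{x,E_x}\}$ with $\mathrm{Inc}$ nesting depth at most $k$. $\mathrm{MTD}_\ell$: graphs with an expression over $\{\bullet,\mathrm{Union},\mathrm{Join}\}\cup\{\mathrm{Subst}_H\mid\mathrm{td}(H)\le\ell\}$. $\mathrm{TD}_k\mathrm{MW}_h$: graphs with an expression over $\{\circ,\bullet,\mathrm{Union},\mathrm{Join}\}\cup\{\mathrm{Inc}_{x,E_x}\}\cup\{\mathrm{Subst}_H\mid|V(H)|\le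 h\}$ with $\mathrm{Inc}$ nesting depth at most $k$. -}

module Defs where

open import Data.Nat using (ℕ; zero; suc; _≤_)
open import Data.Fin using (Fin)
open import Data.Fin.Properties using (_≟_)
open import Data.Bool using (Bool; true; false)
open import Data.Empty using (⊥)
open import Data.Unit using (⊤; tt)
open import Data.Maybe using (Maybe; just; nothing)
open import Data.Product using (Σ; _,_; _×_)
open import Data.Sum using (_⊎_)
open import Relation.Nullary using (¬_; yes; no)
open import Relation.Binary.PropositionalEquality using (_≡_; refl)
open import Function.Bundles using (_↔_; Inverse)

record SGraph (n : ℕ) : Set where
  field
    adj    : Fin n → Fin n → Bool
    sym    : ∀ i j → adj i j ≡ adj j i
    irrefl : ∀ i → adj i i ≡ false
open SGraph public

FinGraph : Set
FinGraph = Σ ℕ SGraph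

IsoTo : ∀ {n} → SGraph n → (V : Set) → (V → V → Bool) → Set
IsoTo {n} G V A =
  Σ (Fin n ↔ V) λ f → ∀ i j → adj G i j ≡ A (Inverse.to f i) (Inverse.to f j)

blockAdj : (t : ℕ) (B : Fin t → Set) (a : ∀ i → B i → B i → Bool)
           (h : Fin t → Fin t → Bool) →
           Σ (Fin t) B → Σ (Fin t) B → Bool
blockAdj t B a h (i , u) (j , v) with i ≟ j
... | yes refl = a i u v
... | no _     = h i j

-- Inc_{x,E_x}: new vertex x = nothing, E_x given by ex : V → Bool.
incAdj : {V : Set} → (V → V → Bool) → (V → Bool) →
         Maybe V → Maybe V → Bool
incAdj a ex nothing  nothing  = false
incAdj a ex nothing  (just v) = ex v
incAdj a ex (just u) nothing  = ex u
incAdj a ex (just u) (just v) = a u v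

allFalse : ∀ {t} → Fin t → Fin t → Bool
allFalse _ _ = false

allTrue : ∀ {t} → Fin t → Fin t → Bool
allTrue _ _ = true

-- Tree-depth expressions over {∘, Union} ∪ {Inc_{x,E_x}}.
-- TDE k = expressions whose Inc nesting depth is at most k.
-- (Induction-recursion: Inc needs the vertex set of its argument.)

data TDE : ℕ → Set
TDV : ∀ {k} → TDE k → Set

data TDE where
  ∘ᵗ     : ∀ {k} → TDE k
  unionᵗ : ∀ {k} (t : ℕ) → 2 ≤ t → (Fin t → TDE k) → TDE k
  incᵗ   : ∀ {k} (e : TDE k) → (TDV e → Bool) → TDE (suc k)

TDV ∘ᵗ             = ⊥
TDV (unionᵗ t _ f) = Σ (Fin t) (λ i → TDV (f i))
TDV (incᵗ e _)     = Maybe (TDV e)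

TDA : ∀ {k} (e : TDE k) → TDV e → TDV e → Bool
TDA ∘ᵗ () ()
TDA (unionᵗ t _ f) = blockAdj t (λ i → TDV (f i)) (λ i → TDA (f i)) allFalse
TDA (incᵗ e ex)    = incAdj (TDA e) ex

TD≤ : ℕ → ∀ {t} → SGraph t → Set
TD≤ ℓ H = Σ (TDE ℓ) λ e → IsoTo H (TDV e) (TDA e)

data MTE (ℓ : ℕ) : Set where
  •ᵐ     : MTE ℓ
  unionᵐ : (t : ℕ) → 2 ≤ t → (Fin t → MTE ℓ) → MTE ℓ
  joinᵐ  : (t : ℕ) → 2 ≤ t → (Fin t → MTE ℓ) → MTE ℓ
  substᵐ : (t : ℕ) (H : SGraph t) → TD≤ ℓ H → (Fin t → MTE ℓ) → MTE ℓ

MTV : ∀ {ℓ} → MTE ℓ → Set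
MTV •ᵐ               = ⊤
MTV (unionᵐ t _ f)   = Σ (Fin t) (λ i → MTV (f i))
MTV (joinᵐ t _ f)    = Σ (Fin t) (λ i → MTV (f i))
MTV (substᵐ t _ _ f) = Σ (Fin t) (λ i → MTV (f i))

MTA : ∀ {ℓ} (e : MTE ℓ) → MTV e → MTV e → Bool
MTA •ᵐ _ _ = false
MTA (unionᵐ t _ f)   = blockAdj t (λ i → MTV (f i)) (λ i → MTA (f i)) allFalse
MTA (joinᵐ t _ f)    = blockAdj t (λ i → MTV (f i)) (λ i → MTA (f i)) allTrue
MTA (substᵐ t H _ f) = blockAdj t (λ i → MTV (f i)) (λ i → MTA (f i)) (adj H)

-- G ∈ MTD_ℓ  (the empty graph corresponds to the empty expression)
InMTD : ℕ → FinGraph → Set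
InMTD ℓ (n , G) = (n ≡ 0) ⊎ Σ (MTE ℓ) λ e → IsoTo G (MTV e) (MTA e)

data TME (h : ℕ) : ℕ → Set
TMV : ∀ {h k} → TME h k → Set

data TME h where
  ∘ʷ     : ∀ {k} → TME h k
  •ʷ     : ∀ {k} → TME h k
  unionʷ : ∀ {k} (t : ℕ) → 2 ≤ t → (Fin t → TME h k) → TME h k
  joinʷ  : ∀ {k} (t : ℕ) → 2 ≤ t → (Fin t → TME h k) → TME h k
  incʷ   : ∀ {k} (e : TME h k) → (TMV e → Bool) → TME h (suc k)
  substʷ : ∀ {k} (t : ℕ) (H : SGraph t) → t ≤ h → (Fin t → TME h k) → TME h k

TMV ∘ʷ               = ⊥
TMV •ʷ               = ⊤
TMV (unionʷ t _ f)   = Σ (Fin t) (λ i → TMV (f i))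
TMV (joinʷ t _ f)    = Σ (Fin t) (λ i → TMV (f i))
TMV (incʷ e _)       = Maybe (TMV e)
TMV (substʷ t _ _ f) = Σ (Fin t) (λ i → TMV (f i))

TMA : ∀ {h k} (e : TME h k) → TMV e → TMV e → Bool
TMA ∘ʷ () ()
TMA •ʷ _ _ = false
TMA (unionʷ t _ f)   = blockAdj t (λ i → TMV (f i)) (λ i → TMA (f i)) allFalse
TMA (joinʷ t _ f)    = blockAdj t (λ i → TMV (f i)) (λ i → TMA (f i)) allTrue
TMA (incʷ e ex)      = incAdj (TMA e) ex
TMA (substʷ t H _ f) = blockAdj t (λ i → TMV (f i)) (λ i → TMA (f i)) (adj H)

InTDMW : ℕ → ℕ → FinGraph → Set
InTDMW k h (n , G) = Σ (TME h k) λ e → IsoTo G (TMV e) (TMA e)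

{-# OPTIONS --safe #-}
module Submission where

open import Defs hiding (sym)
open import Data.Nat using (ℕ; zero; suc; _≤_; z≤n; s≤s; _*_)
open import Data.Fin using (Fin; zero; suc; punchIn; inject₁)
open import Data.Fin.Properties
  using (_≟_; *↔×; punchIn-injective; punchInᵢ≢i; inject₁-injective; ¬∀⟶∃¬; any?; all?)
open import Data.Bool using (Bool; true; false)
open import Data.Empty using (⊥; ⊥-elim)
open import Data.Unit using (tt)
open import Data.Maybe using (Maybe; just; nothing)
open import Data.Product using (Σ; ∃₂; _×_; _,_; proj₁; proj₂)
open import Data.Sum using (inj₁; inj₂)
open import Relation.Nullary using (¬_; yes; no; Dec; contradiction)
open import Relation.Unary using (Decidable)
open import Relation.Binary.PropositionalEquality
open import Function.Bundles using (_↔_; Inverse; mk↔ₛ′)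

-- The witness is the cocktail party graph on ℓ + 2 pairs {a i, b i} with an apex
-- adjacent to every a i: one Inc over a Join of Unions.  In it, every module
-- containing some pair {a i, b i}, or two vertices a i, a j, is the whole graph.
-- An MTD_ℓ expression is decomposed top-down: at a Union two adjacent a's, at a
-- Join a non-adjacent pair {a i, b i}, and at a Subst_H two clique vertices among
-- a 0, …, a ℓ (a graph of tree-depth ≤ ℓ has no (ℓ+1)-clique) land in one block,
-- so the whole graph embeds into a single argument, and at • nothing is left.

module _ {V : Set} where

  NotClique : ∀ {n} → (V → V → Bool) → (Fin n → V) → Set
  NotClique A c = ∃₂ λ p q → p ≢ q × A (c p) (c q) ≡ false

  CliqueFree : (V → V → Bool) → ℕ → Set
  CliqueFree A n = (c : Fin n → V) → NotClique A c

  IsModule : (V → V → Bool) → (V → Set) → Set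
  IsModule A P = ∀ {u v w} → P u → P v → ¬ P w → A w u ≡ A w v

  splitter∈module : {A : V → V → Bool} {P : V → Set} → Decidable P → IsModule A P →
                    ∀ {u v w} → P u → P v → A w u ≡ true → A w v ≡ false → P w
  splitter∈module P? mod {w = w} Pu Pv wu wv with P? w
  ... | yes Pw = Pw
  ... | no ¬Pw = contradiction (trans (sym wu) (trans (mod Pu Pv ¬Pw) wv)) λ ()

record IsFullHom {V W : Set} (A : V → V → Bool) (A′ : W → W → Bool) (φ : V → W) : Set where
  constructor fullHom
  field adj-≡ : ∀ u v → A u v ≡ A′ (φ u) (φ v)
open IsFullHom public

module _ {t : ℕ} {B : Fin t → Set} {α : ∀ i → B i → B i → Bool}
         {h : Fin t → Fin t → Bool} where

  blockAdj-same : ∀ i u v → blockAdj t B α h (i , u) (i , v) ≡ α i u v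
  blockAdj-same i u v with i ≟ i
  ... | yes refl = refl
  ... | no i≢i   = contradiction refl i≢i

  blockAdj-diff : ∀ w w′ → proj₁ w ≢ proj₁ w′ →
                  blockAdj t B α h w w′ ≡ h (proj₁ w) (proj₁ w′)
  blockAdj-diff (i , u) (j , v) i≢j with i ≟ j
  ... | yes refl = contradiction refl i≢j
  ... | no _     = refl

  blockAdj-sym : (∀ i u v → α i u v ≡ α i v u) → (∀ i j → h i j ≡ h j i) →
                 ∀ w w′ → blockAdj t B α h w w′ ≡ blockAdj t B α h w′ w
  blockAdj-sym α-sym h-sym (i , u) (j , v) with i ≟ j | j ≟ i
  ... | yes refl | yes refl = α-sym i u v
  ... | yes refl | no i≢i   = contradiction refl i≢i
  ... | no j≢j   | yes refl = contradiction refl j≢j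
  ... | no _     | no _     = h-sym i j

  blockAdj-irrefl : (∀ i u → α i u u ≡ false) → ∀ w → blockAdj t B α h w w ≡ false
  blockAdj-irrefl α-irr (i , u) = trans (blockAdj-same i u u) (α-irr i u)

  private
    pick : ∀ k (w : Σ (Fin t) B) → proj₁ w ≡ k → B k
    pick k (.k , u) refl = u

    blockAdj-pick : ∀ k w w′ (p : proj₁ w ≡ k) (p′ : proj₁ w′ ≡ k) →
                    blockAdj t B α h w w′ ≡ α k (pick k w p) (pick k w′ p′)
    blockAdj-pick k (.k , u) (.k , v) refl refl = blockAdj-same k u v

  into-one-block : {X : Set} (φ : X → Σ (Fin t) B) → ∀ k → (∀ x → proj₁ (φ x) ≡ k) →
                   Σ (X → B k) λ ψ → ∀ x y → blockAdj t B α h (φ x) (φ y) ≡ α k (ψ x) (ψ y)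
  into-one-block φ k inK =
    (λ x → pick k (φ x) (inK x)) , λ x y → blockAdj-pick k (φ x) (φ y) (inK x) (inK y)

  module _ {V : Set} {A : V → V → Bool} {φ : V → Σ (Fin t) B}
           (hom : IsFullHom A (blockAdj t B α h) φ) where

    block-isModule : ∀ k → IsModule A (λ w → proj₁ (φ w) ≡ k)
    block-isModule k {u} {v} {w} uk vk w≢k = begin
      A w u                         ≡⟨ adj-≡ hom w u ⟩
      blockAdj t B α h (φ w) (φ u)  ≡⟨ blockAdj-diff (φ w) (φ u) (λ e → w≢k (trans e uk)) ⟩
      h (proj₁ (φ w)) (proj₁ (φ u)) ≡⟨ cong (h _) (trans uk (sym vk)) ⟩
      h (proj₁ (φ w)) (proj₁ (φ v)) ≡⟨ blockAdj-diff (φ w) (φ v) (λ e → w≢k (trans e vk)) ⟨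
      blockAdj t B α h (φ w) (φ v)  ≡⟨ adj-≡ hom w v ⟨
      A w v                         ∎
      where open ≡-Reasoning

    sameBlock : ∀ {u v} → A u v ≢ h (proj₁ (φ u)) (proj₁ (φ v)) →
                proj₁ (φ u) ≡ proj₁ (φ v)
    sameBlock {u} {v} mismatch with proj₁ (φ u) ≟ proj₁ (φ v)
    ... | yes same = same
    ... | no diff  =
      contradiction (trans (adj-≡ hom u v) (blockAdj-diff (φ u) (φ v) diff)) mismatch

    fullHom-into-block : ∀ k → (∀ w → proj₁ (φ w) ≡ k) → Σ (V → B k) (IsFullHom A (α k))
    fullHom-into-block k inK =
      let (ψ , ψ-adj) = into-one-block φ k inK
      in ψ , fullHom λ u v → trans (adj-≡ hom u v) (ψ-adj u v)

-- A graph of tree-depth at most k has no (k+1)-clique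

union-cliqueFree : ∀ {t n} {B : Fin t → Set} {α : ∀ i → B i → B i → Bool} →
                   (∀ i → CliqueFree (α i) (suc n)) →
                   CliqueFree (blockAdj t B α allFalse) (suc n)
union-cliqueFree {n = n} free c with all? (λ p → proj₁ (c p) ≟ proj₁ (c zero))
... | yes inOne =
  let (ψ , ψ-adj)            = into-one-block c _ inOne
      (p , q , p≢q , p≁q) = free _ ψ
  in p , q , p≢q , trans (ψ-adj p q) p≁q
... | no ¬inOne =
  let (p , p≢0) = ¬∀⟶∃¬ (suc n) _ (λ p → proj₁ (c p) ≟ proj₁ (c zero)) ¬inOne
  in zero , p , (λ 0≡p → p≢0 (cong (λ r → proj₁ (c r)) (sym 0≡p))) ,
     blockAdj-diff (c zero) (c p) (λ e → p≢0 (sym e))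

module _ {V : Set} {A : V → V → Bool} {ex : V → Bool} {n : ℕ}
         (free : CliqueFree A (suc n)) (c : Fin (suc (suc n)) → Maybe V) where

  private
    isNothing? : (m : Maybe V) → Dec (m ≡ nothing)
    isNothing? nothing  = yes refl
    isNothing? (just _) = no λ ()

    fromJust : (m : Maybe V) → m ≢ nothing → Σ V λ v → m ≡ just v
    fromJust nothing  m≢nothing = contradiction refl m≢nothing
    fromJust (just v) _         = v , refl

    notClique-off : ∀ p → (∀ q → c (punchIn p q) ≢ nothing) → NotClique (incAdj A ex) c
    notClique-off p old =
      let c′ q                = fromJust (c (punchIn p q)) (old q)
          (q , r , q≢r , q≁r) = free (λ q → proj₁ (c′ q))
      in punchIn p q , punchIn p r , (λ e → q≢r (punchIn-injective p q r e)) ,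
         trans (cong₂ (incAdj A ex) (proj₂ (c′ q)) (proj₂ (c′ r))) q≁r

  incAdj-notClique : NotClique (incAdj A ex) c
  incAdj-notClique with any? (λ p → isNothing? (c p))
  ... | no noNew = notClique-off zero (λ q new → noNew (suc q , new))
  ... | yes (p , new) with any? (λ q → isNothing? (c (punchIn p q)))
  ...   | yes (q , new′) = p , punchIn p q , (λ e → punchInᵢ≢i p q (sym e)) ,
                           cong₂ (incAdj A ex) new new′
  ...   | no noNew       = notClique-off p (λ q new′ → noNew (q , new′))

TDA-cliqueFree : ∀ k (e : TDE k) → CliqueFree (TDA e) (suc k)
TDA-cliqueFree k ∘ᵗ c                  = ⊥-elim (c zero)
TDA-cliqueFree k (unionᵗ t _ f)        = union-cliqueFree (λ i → TDA-cliqueFree k (f i))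
TDA-cliqueFree (suc k) (incᵗ e ex) c = incAdj-notClique (TDA-cliqueFree k e) c

incAdj-sym : {V : Set} {A : V → V → Bool} {ex : V → Bool} →
             (∀ u v → A u v ≡ A v u) → ∀ u v → incAdj A ex u v ≡ incAdj A ex v u
incAdj-sym A-sym nothing  nothing  = refl
incAdj-sym A-sym nothing  (just v) = refl
incAdj-sym A-sym (just u) nothing  = refl
incAdj-sym A-sym (just u) (just v) = A-sym u v

TMA-sym : ∀ {h k} (e : TME h k) u v → TMA e u v ≡ TMA e v u
TMA-sym •ʷ               _ _ = refl
TMA-sym (unionʷ t _ f)   = blockAdj-sym (λ i → TMA-sym (f i)) (λ _ _ → refl)
TMA-sym (joinʷ t _ f)    = blockAdj-sym (λ i → TMA-sym (f i)) (λ _ _ → refl)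
TMA-sym (incʷ e ex)      = incAdj-sym (TMA-sym e)
TMA-sym (substʷ t H _ f) = blockAdj-sym (λ i → TMA-sym (f i)) (SGraph.sym H)

TMA-irrefl : ∀ {h k} (e : TME h k) u → TMA e u u ≡ false
TMA-irrefl •ʷ               _        = refl
TMA-irrefl (unionʷ t _ f)   = blockAdj-irrefl (λ i → TMA-irrefl (f i))
TMA-irrefl (joinʷ t _ f)    = blockAdj-irrefl (λ i → TMA-irrefl (f i))
TMA-irrefl (incʷ e ex)      nothing  = refl
TMA-irrefl (incʷ e ex)      (just u) = TMA-irrefl e u
TMA-irrefl (substʷ t H _ f) = blockAdj-irrefl (λ i → TMA-irrefl (f i))

graphOn : ∀ {n} {V : Set} → Fin n ↔ V → (A : V → V → Bool) →
          (∀ u v → A u v ≡ A v u) → (∀ u → A u u ≡ false) → SGraph n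
graphOn ι A A-sym A-irr = record
  { adj    = λ i j → A (to i) (to j)
  ; sym    = λ i j → A-sym (to i) (to j)
  ; irrefl = λ i → A-irr (to i)
  }
  where open Inverse ι

graphOn-isoTo : ∀ {n} {V : Set} (ι : Fin n ↔ V) (A : V → V → Bool) A-sym A-irr →
                IsoTo (graphOn ι A A-sym A-irr) V A
graphOn-isoTo ι A A-sym A-irr = ι , λ _ _ → refl

IsoTo-fullHom : ∀ {n} {G : SGraph n} {V W : Set} {A : V → V → Bool} {A′ : W → W → Bool} →
                IsoTo G V A → IsoTo G W A′ → Σ (V → W) (IsFullHom A A′)
IsoTo-fullHom {G = G} {A = A} {A′} (ι , ι-adj) (κ , κ-adj) =
  (λ v → Inverse.to κ (Inverse.from ι v)) , fullHom λ u v → begin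
    A u v                                   ≡⟨ cong₂ A (toFrom u) (toFrom v) ⟨
    A (Inverse.to ι (Inverse.from ι u)) (Inverse.to ι (Inverse.from ι v))
                                            ≡⟨ ι-adj _ _ ⟨
    adj G (Inverse.from ι u) (Inverse.from ι v)
                                            ≡⟨ κ-adj _ _ ⟩
    A′ _ _                                  ∎
  where
    open ≡-Reasoning
    toFrom : ∀ v → Inverse.to ι (Inverse.from ι v) ≡ v
    toFrom v = Inverse.strictlyInverseˡ ι v

-- The cocktail party graph with an apex

two≤ : ∀ {n} → 2 ≤ suc (suc n)
two≤ = s≤s (s≤s z≤n)

pairOfVertices : TME 0 0
pairOfVertices = unionʷ 2 two≤ (λ _ → •ʷ)

cocktailParty : ℕ → TME 0 0
cocktailParty m = joinʷ (suc (suc m)) two≤ (λ _ → pairOfVertices)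

firstOfPair : ∀ {m} → TMV (cocktailParty m) → Bool
firstOfPair (_ , (zero  , _)) = true
firstOfPair (_ , (suc _ , _)) = false

apexCocktailParty : ℕ → TME 0 1
apexCocktailParty m = incʷ (cocktailParty m) firstOfPair

module ApexCocktailParty (m : ℕ) where

  V : Set
  V = TMV (apexCocktailParty m)

  A : V → V → Bool
  A = TMA (apexCocktailParty m)

  apex : V
  apex = nothing

  a b : Fin (suc (suc m)) → V
  a i = just (i , (zero , tt))
  b i = just (i , (suc zero , tt))

  crossAdj : ∀ {i j u v} → i ≢ j → A (just (i , u)) (just (j , v)) ≡ true
  crossAdj {u = u} {v} i≢j = blockAdj-diff (_ , u) (_ , v) i≢j

  a≁b : ∀ i → A (a i) (b i) ≡ false
  a≁b i = blockAdj-same i (zero , tt) (suc zero , tt)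

  b≁a : ∀ i → A (b i) (a i) ≡ false
  b≁a i = blockAdj-same i (suc zero , tt) (zero , tt)

  module _ {P : V → Set} (P? : Decidable P) (mod : IsModule A P) where

    private
      splitter : ∀ {u v w} → P u → P v → A w u ≡ true → A w v ≡ false → P w
      splitter = splitter∈module P? mod

    module∋ab⇒all : ∀ i → P (a i) → P (b i) → ∀ w → P w
    module∋ab⇒all i ai bi = all
      where
        apex∈ : P apex
        apex∈ = splitter ai bi refl refl

        b∈ : ∀ j → j ≢ i → P (b j)
        b∈ j j≢i = splitter ai apex∈ (crossAdj j≢i) refl

        all : ∀ w → P w
        all nothing = apex∈
        all (just (j , (zero , tt))) with j ≟ i
        ... | yes refl = ai
        ... | no j≢i   = splitter bi (b∈ j j≢i) (crossAdj j≢i) (a≁b j)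
        all (just (j , (suc zero , tt))) with j ≟ i
        ... | yes refl = bi
        ... | no j≢i   = b∈ j j≢i

    module∋aa⇒all : ∀ {i j} → i ≢ j → P (a i) → P (a j) → ∀ w → P w
    module∋aa⇒all {i} i≢j ai aj =
      module∋ab⇒all i ai (splitter aj ai (crossAdj i≢j) (b≁a i))

  firstVertices : Fin (suc m) → V
  firstVertices i = a (inject₁ i)

  firstVertices-clique : ∀ p q → p ≢ q → A (firstVertices p) (firstVertices q) ≡ true
  firstVertices-clique p q p≢q = crossAdj (λ e → p≢q (inject₁-injective e))

  module _ {t : ℕ} {B : Fin t → Set} {α : ∀ i → B i → B i → Bool}
           {h : Fin t → Fin t → Bool} {φ : V → Σ (Fin t) B}
           (hom : IsFullHom A (blockAdj t B α h) φ)
           (ih : ∀ k (ψ : V → B k) → ¬ IsFullHom A (α k) ψ) where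

    private
      β : V → Fin t
      β w = proj₁ (φ w)

      oneBlock⇒⊥ : ∀ k → (∀ w → β w ≡ k) → ⊥
      oneBlock⇒⊥ k inK = let (ψ , ψ-hom) = fullHom-into-block hom k inK in ih k ψ ψ-hom

    sameBlock-ab⇒⊥ : ∀ i → β (a i) ≡ β (b i) → ⊥
    sameBlock-ab⇒⊥ i same =
      oneBlock⇒⊥ _ (module∋ab⇒all (λ w → β w ≟ β (a i)) (block-isModule hom _) i refl (sym same))

    sameBlock-aa⇒⊥ : ∀ {i j} → i ≢ j → β (a i) ≡ β (a j) → ⊥
    sameBlock-aa⇒⊥ i≢j same =
      oneBlock⇒⊥ _ (module∋aa⇒all (λ w → β w ≟ _) (block-isModule hom _) i≢j refl (sym same))

  noFullHom : (e : MTE m) (φ : V → MTV e) → ¬ IsFullHom A (MTA e) φ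
  noFullHom •ᵐ φ hom = contradiction (adj-≡ hom (a zero) (a (suc zero))) λ ()
  noFullHom (unionᵐ t _ f) φ hom =
    sameBlock-aa⇒⊥ hom (λ k → noFullHom (f k)) {zero} {suc zero} (λ ()) (sameBlock hom λ ())
  noFullHom (joinᵐ t _ f) φ hom =
    sameBlock-ab⇒⊥ hom (λ k → noFullHom (f k)) zero (sameBlock hom λ ())
  noFullHom (substᵐ t H (eH , (ι , ι-adj)) f) φ hom =
    let (p , q , p≢q , p≁q) = TDA-cliqueFree m eH (λ p → Inverse.to ι (proj₁ (φ (firstVertices p))))
        p~q                 = firstVertices-clique p q p≢q
    in sameBlock-aa⇒⊥ hom (λ k → noFullHom (f k)) (λ e → p≢q (inject₁-injective e))
         (sameBlock hom λ p~q′ →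
           contradiction (trans (sym p~q) (trans p~q′ (trans (ι-adj _ _) p≁q))) λ ())

  private
    M : ℕ
    M = suc (suc m)

    toV : Fin (suc (M * 2)) → V
    toV zero    = nothing
    toV (suc k) = let (i , j) = Inverse.to *↔× k in just (i , (j , tt))

    fromV : V → Fin (suc (M * 2))
    fromV nothing               = zero
    fromV (just (i , (j , tt))) = suc (Inverse.from (*↔× {M} {2}) (i , j))

  vertices : Fin (suc (M * 2)) ↔ V
  vertices = mk↔ₛ′ toV fromV toFrom fromTo
    where
      toFrom : ∀ w → toV (fromV w) ≡ w
      toFrom nothing               = refl
      toFrom (just (i , (j , tt))) =
        cong (λ (i , j) → just (i , (j , tt))) (Inverse.strictlyInverseˡ (*↔× {M} {2}) (i , j))

      fromTo : ∀ k → fromV (toV k) ≡ k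
      fromTo zero    = refl
      fromTo (suc k) = cong suc (Inverse.strictlyInverseʳ (*↔× {M} {2}) k)

  A-sym : ∀ u v → A u v ≡ A v u
  A-sym = TMA-sym (apexCocktailParty m)

  A-irrefl : ∀ u → A u u ≡ false
  A-irrefl = TMA-irrefl (apexCocktailParty m)

  graph : FinGraph
  graph = _ , graphOn vertices A A-sym A-irrefl

  graph-isoTo : IsoTo (proj₂ graph) V A
  graph-isoTo = graphOn-isoTo vertices A A-sym A-irrefl

  graph∉MTD : ¬ InMTD m graph
  graph∉MTD (inj₁ ())
  graph∉MTD (inj₂ (e , iso)) =
    let (φ , hom) = IsoTo-fullHom {G = proj₂ graph} graph-isoTo iso in noFullHom e φ hom

lemma28 : (ℓ : ℕ) → Σ FinGraph λ G → ¬ InMTD ℓ G × InTDMW 1 0 G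
lemma28 ℓ = graph , graph∉MTD , (apexCocktailParty ℓ , graph-isoTo)
  where open ApexCocktailParty ℓ
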